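{- For integers $m\ge 0$ and $0\le i\le m$, let \[ d_i(m)=2^{ -2m}\sum_{k=i}^{m}2^k\binom{2m-2k}{m-k}\binom{m+k}{k}\binom{k}{i}. \] Then for every integer $m\ge 2$ and every $i$ with $0\le i\le m-1$, \[ \frac{d_i(m)}{d_{i+1}(m)}>\frac{(2i+4m+5)\,d_i(m+1)}{(2i+4m+3)\,d_{i+1}(m+1)}. \]
   Context: $d_i(m)$ is the coefficient of $x^i$ in the Boros–Moll polynomial $P_m(x)=\sum_{j,k}\binom{2m+1}{2j}\binom{m-j}{k}\binom{2k+2j}{k+j}\frac{(x+1)^j(x-1)^k}{2^{3(k+j)}}$; these coefficients are positive for $0\le i\le m$. -}

module Defs where

open import Data.Nat using (ℕ; zero; suc; _+_; _*_; _∸_; _^_)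
open import Data.Nat.Combinatorics using (_C_)
open import Data.Rational using (ℚ; _/_)
open import Data.Integer using (+_)

-- Σ_{k=i}^{m} f k  (empty when i > m)
sumFromTo : ℕ → ℕ → (ℕ → ℕ) → ℕ
sumFromTo i m f = go (suc m ∸ i)
  where
  go : ℕ → ℕ
  go zero = 0
  go (suc n) = f (i + n) + go n

dSum : ℕ → ℕ → ℕ
dSum i m = sumFromTo i m (λ k → 2 ^ k * ((2 * m ∸ 2 * k) C (m ∸ k)) * ((m + k) C k) * (k C i))

d : ℕ → ℕ → ℚ
d i m = _/_ (+ dSum i m) (2 ^ (2 * m)) {{nz}}
  where
  open import Data.Nat.Properties using (m^n≢0)
  nz = m^n≢0 2 (2 * m)

-- Write d_i(m) = 2^{-2m} S_i(m), where S_i(m) (dSum i m in Defs) is Σ_k w_m(k) C(k,i) with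
-- w_m(k) = 2^k C(2m-2k,m-k) C(m+k,k).
-- The 2^{-2m} cancels in each ratio, so the claim is the integer inequality
--   (4m+2i+5) S_i(m+1) S_{i+1}(m) < (4m+2i+3) S_i(m) S_{i+1}(m+1).
-- The weights satisfy three contiguity relations (in m and k together, in m, in k), all consequences
-- of binomial absorption.  Summing them against C(k,i), using (i+1) C(k,i+1) = (k-i) C(k,i), gives
--   (R1)  (m+1) S_{i+1}(m+1) = 4(m+i+1) S_i(m) + 2(4m+2i+5) S_{i+1}(m),
--   (R2)  (m+1-i)(m+1) S_i(m+1) + 4i(i+1) S_{i+1}(m) = 2(2i+4(m-i)+3)(m+i+1) S_i(m),
-- and, termwise, (i+1) S_{i+1}(m) ≤ (m-i) S_i(m).  Eliminating S_i(m+1) and S_{i+1}(m+1) with R1, R2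
-- leaves a quadratic inequality in S_i(m), S_{i+1}(m), which follows from x(y+z) ≤ x² + yz for x ≤ y ≤ z.
module Submission where

open import Defs

module Elementary where
  open import Data.Nat
  open import Data.Nat.Properties
  open import Relation.Binary.PropositionalEquality

  by-offset : ∀ {j m} (Φ : ℕ → Set) → j ≤ m → (∀ r → Φ (j + r)) → Φ m
  by-offset Φ j≤m h = subst Φ (m+[n∸m]≡n j≤m) (h _)

  by-offsets : ∀ {i k m} (Φ : ℕ → ℕ → Set) → i ≤ k → k ≤ m → (∀ t r → Φ (i + t) (i + t + r)) → Φ k m
  by-offsets Φ i≤k k≤m h = by-offset (Φ _) k≤m (λ r → by-offset (λ k → Φ k (k + r)) i≤k (λ t → h t r))

  <-from-pred : ∀ {i m} → 1 ≤ m → i ≤ m ∸ 1 → i < m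
  <-from-pred {m = suc m} _ i≤m = s≤s i≤m

  *-pos : ∀ {x y} → 0 < x → 0 < y → 0 < x * y
  *-pos {suc x} {suc y} _ _ = s≤s z≤n

module Sums where
  open import Data.Nat
  open import Data.Nat.Properties
  open import Data.Nat.Tactic.RingSolver using (solve-∀)
  open import Relation.Binary.PropositionalEquality
  open ≡-Reasoning

  Σ< : ℕ → (ℕ → ℕ) → ℕ
  Σ< zero    f = 0
  Σ< (suc n) f = Σ< n f + f n

  Σ-cong : ∀ n {f g} → (∀ k → k < n → f k ≡ g k) → Σ< n f ≡ Σ< n g
  Σ-cong zero    eq = refl
  Σ-cong (suc n) eq = cong₂ _+_ (Σ-cong n (λ k k<n → eq k (m<n⇒m<1+n k<n))) (eq n ≤-refl)

  Σ-mono : ∀ n {f g} → (∀ k → k < n → f k ≤ g k) → Σ< n f ≤ Σ< n g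
  Σ-mono zero    le = ≤-refl
  Σ-mono (suc n) le = +-mono-≤ (Σ-mono n (λ k k<n → le k (m<n⇒m<1+n k<n))) (le n ≤-refl)

  Σ-vanish : ∀ n {f} → (∀ k → k < n → f k ≡ 0) → Σ< n f ≡ 0
  Σ-vanish zero    eq = refl
  Σ-vanish (suc n) eq = cong₂ _+_ (Σ-vanish n (λ k k<n → eq k (m<n⇒m<1+n k<n))) (eq n ≤-refl)

  Σ-+ : ∀ n f g → Σ< n (λ k → f k + g k) ≡ Σ< n f + Σ< n g
  Σ-+ zero    f g = refl
  Σ-+ (suc n) f g = trans (cong (_+ (f n + g n)) (Σ-+ n f g)) (interchange (Σ< n f) (Σ< n g) (f n) (g n))
    where
    interchange : ∀ a b c d → a + b + (c + d) ≡ a + c + (b + d)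
    interchange = solve-∀

  Σ-scale : ∀ n c f → Σ< n (λ k → c * f k) ≡ c * Σ< n f
  Σ-scale zero    c f = sym (*-zeroʳ c)
  Σ-scale (suc n) c f = trans (cong (_+ c * f n) (Σ-scale n c f)) (sym (*-distribˡ-+ c (Σ< n f) (f n)))

  Σ-shift : ∀ n f → Σ< (suc n) f ≡ f 0 + Σ< n (λ k → f (suc k))
  Σ-shift zero    f = sym (+-identityʳ (f 0))
  Σ-shift (suc n) f = trans (cong (_+ f (suc n)) (Σ-shift n f)) (+-assoc (f 0) _ (f (suc n)))

  sumFromTo-split : ∀ i n f → sumFromTo i (i + n) f + Σ< i f ≡ Σ< (suc (i + n)) f
  sumFromTo-split i zero f
    rewrite +-∸-assoc 1 (m≤m+n i 0) | m+n∸m≡n i 0 | +-identityʳ i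
    = trans (cong (_+ Σ< i f) (+-identityʳ (f i))) (+-comm (f i) (Σ< i f))
  sumFromTo-split i (suc n) f = begin
    sumFromTo i (i + suc n) f + Σ< i f              ≡⟨ cong (_+ Σ< i f) step ⟩
    f (i + suc n) + sumFromTo i (i + n) f + Σ< i f  ≡⟨ +-assoc (f (i + suc n)) _ _ ⟩
    f (i + suc n) + (sumFromTo i (i + n) f + Σ< i f) ≡⟨ cong (f (i + suc n) +_) (sumFromTo-split i n f) ⟩
    f (i + suc n) + Σ< (suc (i + n)) f              ≡⟨ +-comm (f (i + suc n)) _ ⟩
    Σ< (suc (i + n)) f + f (i + suc n)              ≡⟨ cong (λ j → Σ< j f + f (i + suc n)) (+-suc i n) ⟨
    Σ< (suc (i + suc n)) f                          ∎
    where
    step : sumFromTo i (i + suc n) f ≡ f (i + suc n) + sumFromTo i (i + n) f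
    step rewrite +-∸-assoc 1 (m≤m+n i (suc n)) | +-∸-assoc 1 (m≤m+n i n)
               | m+n∸m≡n i (suc n) | m+n∸m≡n i n = refl

  sumFromTo≡Σ : ∀ {i m} f → i ≤ m → (∀ k → k < i → f k ≡ 0) → sumFromTo i m f ≡ Σ< (suc m) f
  sumFromTo≡Σ {i} {m} f i≤m vanish = begin
    sumFromTo i m f         ≡⟨ +-identityʳ _ ⟨
    sumFromTo i m f + 0     ≡⟨ cong (sumFromTo i m f +_) (Σ-vanish i vanish) ⟨
    sumFromTo i m f + Σ< i f ≡⟨ subst (λ m → sumFromTo i m f + Σ< i f ≡ Σ< (suc m) f)
                                     (m+[n∸m]≡n i≤m) (sumFromTo-split i (m ∸ i) f) ⟩
    Σ< (suc m) f            ∎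

module Binomial where
  open import Data.Nat
  open import Data.Nat.Properties
  open import Algebra.Properties.CommutativeSemigroup *-commutativeSemigroup using (x∙yz≈y∙xz)
  open import Data.Nat.Combinatorics using (_C_; nC1≡n; nCk+nC[k+1]≡[n+1]C[k+1]; k>n⇒nCk≡0)
  open import Data.Nat.Tactic.RingSolver using (solve-∀)
  open import Relation.Binary.PropositionalEquality
  open import Relation.Nullary using (yes; no)
  open ≡-Reasoning

  C-absorb : ∀ n k → suc k * (suc n C suc k) ≡ suc n * (n C k)
  C-absorb n zero = trans (+-identityʳ (suc n C 1)) (trans (nC1≡n (suc n)) (sym (*-identityʳ (suc n))))
  C-absorb zero (suc k) = *-zeroʳ (suc (suc k))
  C-absorb (suc n) (suc k) = begin
    (2 + k) * (suc (suc n) C suc (suc k))   ≡⟨ cong ((2 + k) *_) (nCk+nC[k+1]≡[n+1]C[k+1] (suc n) (suc k)) ⟨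
    (2 + k) * (X + Y)                       ≡⟨ regroup k X Y ⟩
    X + ((1 + k) * X + (2 + k) * Y)         ≡⟨ cong₂ (λ a b → X + (a + b)) (C-absorb n k) (C-absorb n (suc k)) ⟩
    X + ((1 + n) * (n C k) + (1 + n) * (n C suc k))
                                            ≡⟨ cong (X +_) (*-distribˡ-+ (1 + n) (n C k) (n C suc k)) ⟨
    X + (1 + n) * (n C k + n C suc k)       ≡⟨ cong (λ z → X + (1 + n) * z) (nCk+nC[k+1]≡[n+1]C[k+1] n k) ⟩
    X + (1 + n) * X                         ∎
    where
    X Y : ℕ
    X = suc n C suc k
    Y = suc n C suc (suc k)
    regroup : ∀ k X Y → (2 + k) * (X + Y) ≡ X + ((1 + k) * X + (2 + k) * Y)
    regroup = solve-∀

  -- (n+1) C(n, k) + k C(n+1, k) = (n+1) C(n+1, k),  i.e. (n+1-k) C(n+1,k) = (n+1) C(n,k)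
  C-top : ∀ n k → suc n * (n C k) + k * (suc n C k) ≡ suc n * (suc n C k)
  C-top n zero = +-identityʳ _
  C-top n (suc k) = begin
    suc n * (n C suc k) + suc k * (suc n C suc k) ≡⟨ cong (suc n * (n C suc k) +_) (C-absorb n k) ⟩
    suc n * (n C suc k) + suc n * (n C k)         ≡⟨ *-distribˡ-+ (suc n) (n C suc k) (n C k) ⟨
    suc n * (n C suc k + n C k)                   ≡⟨ cong (suc n *_) (+-comm (n C suc k) (n C k)) ⟩
    suc n * (n C k + n C suc k)                   ≡⟨ cong (suc n *_) (nCk+nC[k+1]≡[n+1]C[k+1] n k) ⟩
    suc n * (suc n C suc k)                       ∎

  C-top′ : ∀ k t → suc t * (suc (k + t) C k) ≡ suc (k + t) * ((k + t) C k)
  C-top′ k t = +-cancelʳ-≡ (k * X) _ _ (begin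
    suc t * X + k * X                 ≡⟨ *-distribʳ-+ X (suc t) k ⟨
    (suc t + k) * X                   ≡⟨ cong (_* X) (+-comm (suc t) k) ⟩
    (k + suc t) * X                   ≡⟨ cong (_* X) (+-suc k t) ⟩
    suc (k + t) * X                   ≡⟨ C-top (k + t) k ⟨
    suc (k + t) * ((k + t) C k) + k * X ∎)
    where
    X : ℕ
    X = suc (k + t) C k

  C-lower-sum : ∀ n i → suc i * (n C suc i) + i * (n C i) ≡ n * (n C i)
  C-lower-sum zero zero = refl
  C-lower-sum zero (suc i) = cong₂ _+_ (*-zeroʳ (2 + i)) (*-zeroʳ (1 + i))
  C-lower-sum (suc n) i = trans (cong (_+ i * (suc n C i)) (C-absorb n i)) (C-top n i)

  -- (i+1) C(n, i+1) = (n - i) C(n, i)   (both sides vanish when n < i)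
  C-lower : ∀ n i → suc i * (n C suc i) ≡ (n ∸ i) * (n C i)
  C-lower n i with i ≤? n
  ... | yes i≤n = +-cancelʳ-≡ (i * (n C i)) _ _ (begin
    suc i * (n C suc i) + i * (n C i)   ≡⟨ C-lower-sum n i ⟩
    n * (n C i)                         ≡⟨ cong (_* (n C i)) (m∸n+n≡m i≤n) ⟨
    (n ∸ i + i) * (n C i)               ≡⟨ *-distribʳ-+ (n C i) (n ∸ i) i ⟩
    (n ∸ i) * (n C i) + i * (n C i)     ∎)
  ... | no i≰n = begin
    suc i * (n C suc i)     ≡⟨ cong (suc i *_) (k>n⇒nCk≡0 (m<n⇒m<1+n n<i)) ⟩
    suc i * 0               ≡⟨ *-zeroʳ (suc i) ⟩
    0                       ≡⟨ *-zeroʳ (n ∸ i) ⟨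
    (n ∸ i) * 0             ≡⟨ cong ((n ∸ i) *_) (k>n⇒nCk≡0 n<i) ⟨
    (n ∸ i) * (n C i)       ∎
    where
    n<i : n < i
    n<i = ≰⇒> i≰n

  C-central : ∀ r → suc r * ((2 * suc r) C suc r) ≡ 2 * (2 * r + 1) * ((2 * r) C r)
  C-central r = *-cancelˡ-≡ _ _ (suc r) (begin
    suc r * (suc r * ((2 * suc r) C suc r))   ≡⟨ cong (λ z → suc r * (suc r * (z C suc r))) (*-suc 2 r) ⟩
    suc r * (suc r * (suc (suc n) C suc r))   ≡⟨ cong (suc r *_) (C-absorb (suc n) r) ⟩
    suc r * (suc (suc n) * (suc n C r))       ≡⟨ x∙yz≈y∙xz (suc r) (suc (suc n)) (suc n C r) ⟩
    suc (suc n) * (suc r * (suc n C r))       ≡⟨ cong (λ z → suc (suc n) * (suc r * (suc z C r))) n≡r+r ⟩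
    suc (suc n) * (suc r * (suc (r + r) C r)) ≡⟨ cong (suc (suc n) *_) (C-top′ r r) ⟩
    suc (suc n) * (suc (r + r) * ((r + r) C r)) ≡⟨ cong (λ z → suc (suc n) * (suc z * (z C r))) n≡r+r ⟨
    suc (suc n) * (suc n * (n C r))           ≡⟨ collect r (n C r) ⟩
    suc r * (2 * (2 * r + 1) * (n C r))       ∎)
    where
    n : ℕ
    n = 2 * r
    n≡r+r : n ≡ r + r
    n≡r+r = cong (r +_) (+-identityʳ r)
    collect : ∀ r c → (2 + 2 * r) * ((1 + 2 * r) * c) ≡ (1 + r) * (2 * (2 * r + 1) * c)
    collect = solve-∀

  C-shift : ∀ k i → (suc k ∸ i) * (suc k C i) ≡ suc k * (k C i)
  C-shift k i = trans (sym (C-lower (suc k) i)) (C-absorb k i)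

  C-pos : ∀ {n k} → k ≤ n → 0 < n C k
  C-pos {n} {zero} _ = s≤s z≤n
  C-pos {suc n} {suc k} (s≤s k≤n) =
    subst (0 <_) (nCk+nC[k+1]≡[n+1]C[k+1] n k) (<-≤-trans (C-pos k≤n) (m≤m+n _ _))

module Weights where
  open import Data.Nat
  open import Data.Nat.Properties
  open import Algebra.Properties.CommutativeSemigroup *-commutativeSemigroup using (x∙yz≈y∙xz)
  open import Data.Nat.Combinatorics using (_C_)
  open import Data.Nat.Tactic.RingSolver using (solve-∀)
  open import Relation.Binary.PropositionalEquality
  open ≡-Reasoning
  open Elementary
  open Binomial

  w : ℕ → ℕ → ℕ
  w m k = 2 ^ k * ((2 * m ∸ 2 * k) C (m ∸ k)) * ((m + k) C k)

  -- the weight in offset coordinates m = k + r, and an auxiliary "half step" between them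
  W V : ℕ → ℕ → ℕ
  W k r = 2 ^ k * ((2 * r) C r) * ((k + (k + r)) C k)
  V k r = 2 ^ k * ((2 * r) C r) * (suc (k + (k + r)) C k)

  w-offset : ∀ k r → w (k + r) k ≡ W k r
  w-offset k r = cong₃ (λ a b c → 2 ^ k * (a C b) * (c C k)) 2m-2k≡2r (m+n∸m≡n k r) (+-comm (k + r) k)
    where
    cong₃ : ∀ (f : ℕ → ℕ → ℕ → ℕ) {a a′ b b′ c c′} → a ≡ a′ → b ≡ b′ → c ≡ c′ → f a b c ≡ f a′ b′ c′
    cong₃ f refl refl refl = refl
    2m-2k≡2r : 2 * (k + r) ∸ 2 * k ≡ 2 * r
    2m-2k≡2r = trans (cong (_∸ 2 * k) (*-distribˡ-+ 2 k r)) (m+n∸m≡n (2 * k) (2 * r))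

  W-suc-k : ∀ k r → suc k * W (suc k) r ≡ 2 * (2 + (k + (k + r))) * V k r
  W-suc-k k r = begin
    suc k * (2 ^ suc k * X * ((suc k + (suc k + r)) C suc k))
      ≡⟨ cong (λ n → suc k * (2 ^ suc k * X * (n C suc k))) (cong suc (+-suc k (k + r))) ⟩
    suc k * (2 * 2 ^ k * X * (suc (suc N) C suc k))
      ≡⟨ pull-out (suc k) (2 ^ k) X (suc (suc N) C suc k) ⟩
    2 * (2 ^ k * X) * (suc k * (suc (suc N) C suc k))
      ≡⟨ cong (2 * (2 ^ k * X) *_) (C-absorb (suc N) k) ⟩
    2 * (2 ^ k * X) * (suc (suc N) * (suc N C k))
      ≡⟨ push-in (2 ^ k * X) (suc (suc N)) (suc N C k) ⟩
    2 * (2 + N) * V k r ∎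
    where
    N X : ℕ
    N = k + (k + r)
    X = (2 * r) C r
    pull-out : ∀ a p x c → a * (2 * p * x * c) ≡ 2 * (p * x) * (a * c)
    pull-out = solve-∀
    push-in : ∀ y n c → 2 * y * (n * c) ≡ 2 * n * (y * c)
    push-in = solve-∀

  W-suc-r : ∀ k r → suc r * W k (suc r) ≡ 2 * (2 * r + 1) * V k r
  W-suc-r k r = begin
    suc r * (2 ^ k * C2 * ((k + (k + suc r)) C k))
      ≡⟨ cong (λ n → suc r * (2 ^ k * C2 * (n C k))) (trans (cong (k +_) (+-suc k r)) (+-suc k (k + r))) ⟩
    suc r * (2 ^ k * C2 * (suc N C k))
      ≡⟨ x[pyc]≡p[xy]c (suc r) (2 ^ k) C2 (suc N C k) ⟩
    2 ^ k * (suc r * C2) * (suc N C k)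
      ≡⟨ cong (λ z → 2 ^ k * z * (suc N C k)) (C-central r) ⟩
    2 ^ k * (2 * (2 * r + 1) * X) * (suc N C k)
      ≡⟨ x[pyc]≡p[xy]c (2 * (2 * r + 1)) (2 ^ k) X (suc N C k) ⟨
    2 * (2 * r + 1) * V k r ∎
    where
    N X C2 : ℕ
    N = k + (k + r)
    X = (2 * r) C r
    C2 = (2 * suc r) C suc r
    x[pyc]≡p[xy]c : ∀ x p y c → x * (p * y * c) ≡ p * (x * y) * c
    x[pyc]≡p[xy]c = solve-∀

  V-W : ∀ k r → suc (k + r) * V k r ≡ suc (k + (k + r)) * W k r
  V-W k r = begin
    suc (k + r) * (2 ^ k * X * (suc N C k))   ≡⟨ x∙yz≈y∙xz (suc (k + r)) (2 ^ k * X) (suc N C k) ⟩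
    2 ^ k * X * (suc (k + r) * (suc N C k))   ≡⟨ cong (2 ^ k * X *_) (C-top′ k (k + r)) ⟩
    2 ^ k * X * (suc N * (N C k))             ≡⟨ x∙yz≈y∙xz (2 ^ k * X) (suc N) (N C k) ⟩
    suc N * W k r                             ∎
    where
    N X : ℕ
    N = k + (k + r)
    X = (2 * r) C r

  w-step-mk : ∀ {m j} → j ≤ m → suc m * (suc j * w (suc m) (suc j)) ≡ 2 * ((m + j + 1) * (m + j + 2)) * w m j
  w-step-mk {j = j} j≤m = by-offset Φ j≤m at-offset
    where
    Φ : ℕ → Set
    Φ m = suc m * (suc j * w (suc m) (suc j)) ≡ 2 * ((m + j + 1) * (m + j + 2)) * w m j
    regroup : ∀ j r c → 2 * (2 + (j + (j + r))) * ((1 + (j + (j + r))) * c) ≡ 2 * ((j + r + j + 1) * (j + r + j + 2)) * c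
    regroup = solve-∀
    at-offset : ∀ r → Φ (j + r)
    at-offset r = begin
      suc (j + r) * (suc j * w (suc j + r) (suc j)) ≡⟨ cong (λ z → suc (j + r) * (suc j * z)) (w-offset (suc j) r) ⟩
      suc (j + r) * (suc j * W (suc j) r)         ≡⟨ cong (suc (j + r) *_) (W-suc-k j r) ⟩
      suc (j + r) * (2 * (2 + N) * V j r)         ≡⟨ x∙yz≈y∙xz (suc (j + r)) (2 * (2 + N)) (V j r) ⟩
      2 * (2 + N) * (suc (j + r) * V j r)         ≡⟨ cong (2 * (2 + N) *_) (V-W j r) ⟩
      2 * (2 + N) * (suc N * W j r)               ≡⟨ regroup j r (W j r) ⟩
      2 * ((j + r + j + 1) * (j + r + j + 2)) * W j r   ≡⟨ cong (2 * ((j + r + j + 1) * (j + r + j + 2)) *_) (w-offset j r) ⟨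
      2 * ((j + r + j + 1) * (j + r + j + 2)) * w (j + r) j ∎
      where
      N : ℕ
      N = j + (j + r)

  suc-offset-∸ : ∀ k r → suc (k + r) ∸ k ≡ suc r
  suc-offset-∸ k r = trans (cong (_∸ k) (sym (+-suc k r))) (m+n∸m≡n k (suc r))

  w-offset-suc : ∀ k r → w (suc (k + r)) k ≡ W k (suc r)
  w-offset-suc k r = trans (cong (λ n → w n k) (sym (+-suc k r))) (w-offset k (suc r))

  w-step-m : ∀ {m k} → k ≤ m → (suc m ∸ k) * (suc m * w (suc m) k) ≡ 2 * ((2 * (m ∸ k) + 1) * (suc m + k)) * w m k
  w-step-m {k = k} k≤m = by-offset Φ k≤m at-offset
    where
    Φ : ℕ → Set
    Φ m = (suc m ∸ k) * (suc m * w (suc m) k) ≡ 2 * ((2 * (m ∸ k) + 1) * (suc m + k)) * w m k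
    regroup : ∀ k r c → 2 * (2 * r + 1) * ((1 + (k + (k + r))) * c) ≡ 2 * ((2 * r + 1) * (1 + (k + r) + k)) * c
    regroup = solve-∀
    at-offset : ∀ r → Φ (k + r)
    at-offset r = begin
      (suc (k + r) ∸ k) * (suc (k + r) * w (suc (k + r)) k)
        ≡⟨ cong₂ (λ a b → a * (suc (k + r) * b)) (suc-offset-∸ k r) (w-offset-suc k r) ⟩
      suc r * (suc (k + r) * W k (suc r))        ≡⟨ x∙yz≈y∙xz (suc r) (suc (k + r)) (W k (suc r)) ⟩
      suc (k + r) * (suc r * W k (suc r))        ≡⟨ cong (suc (k + r) *_) (W-suc-r k r) ⟩
      suc (k + r) * (2 * (2 * r + 1) * V k r)    ≡⟨ x∙yz≈y∙xz (suc (k + r)) (2 * (2 * r + 1)) (V k r) ⟩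
      2 * (2 * r + 1) * (suc (k + r) * V k r)    ≡⟨ cong (2 * (2 * r + 1) *_) (V-W k r) ⟩
      2 * (2 * r + 1) * (suc (k + (k + r)) * W k r) ≡⟨ regroup k r (W k r) ⟩
      2 * ((2 * r + 1) * (suc (k + r) + k)) * W k r
        ≡⟨ cong₂ (λ a b → 2 * ((2 * a + 1) * (suc (k + r) + k)) * b) (m+n∸m≡n k r) (w-offset k r) ⟨
      2 * ((2 * (k + r ∸ k) + 1) * (suc (k + r) + k)) * w (k + r) k ∎

  w-step-k : ∀ {m j} → j < m → (2 * (m ∸ suc j) + 1) * (suc j * w m (suc j)) ≡ (m ∸ j) * (m + j + 1) * w m j
  w-step-k {j = j} j<m = by-offset Φ j<m at-offset
    where
    Φ : ℕ → Set
    Φ m = (2 * (m ∸ suc j) + 1) * (suc j * w m (suc j)) ≡ (m ∸ j) * (m + j + 1) * w m j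
    swap : ∀ r n c → (2 * r + 1) * (2 * n * c) ≡ n * (2 * (2 * r + 1) * c)
    swap = solve-∀
    regroup : ∀ j r c → (2 + (j + (j + r))) * (suc r * c) ≡ suc r * (suc (j + r) + j + 1) * c
    regroup = solve-∀
    at-offset : ∀ r → Φ (suc j + r)
    at-offset r = begin
      (2 * (suc j + r ∸ suc j) + 1) * (suc j * w (suc j + r) (suc j))
        ≡⟨ cong₂ (λ a b → (2 * a + 1) * (suc j * b)) (m+n∸m≡n (suc j) r) (w-offset (suc j) r) ⟩
      (2 * r + 1) * (suc j * W (suc j) r)           ≡⟨ cong ((2 * r + 1) *_) (W-suc-k j r) ⟩
      (2 * r + 1) * (2 * (2 + N) * V j r)           ≡⟨ swap r (2 + N) (V j r) ⟩
      (2 + N) * (2 * (2 * r + 1) * V j r)           ≡⟨ cong ((2 + N) *_) (W-suc-r j r) ⟨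
      (2 + N) * (suc r * W j (suc r))               ≡⟨ regroup j r (W j (suc r)) ⟩
      suc r * (suc (j + r) + j + 1) * W j (suc r)
        ≡⟨ cong₂ (λ a b → a * (suc (j + r) + j + 1) * b) (suc-offset-∸ j r) (w-offset-suc j r) ⟨
      (suc j + r ∸ j) * (suc j + r + j + 1) * w (suc j + r) j ∎
      where
      N : ℕ
      N = j + (j + r)

module Moments where
  open import Data.Nat
  open import Data.Nat.Properties
  open import Algebra.Properties.CommutativeSemigroup *-commutativeSemigroup using (x∙yz≈y∙xz)
  open import Data.Nat.Combinatorics using (_C_; k>n⇒nCk≡0)
  open import Data.Nat.Tactic.RingSolver using (solve-∀)
  open import Relation.Binary.PropositionalEquality
  open import Relation.Nullary using (yes; no)
  open ≡-Reasoning
  open Sums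
  open Binomial
  open Weights

  term : ℕ → ℕ → ℕ → ℕ
  term i m k = w m k * (k C i)

  M : ℕ → ℕ → (ℕ → ℕ) → ℕ
  M i m p = Σ< (suc m) (λ k → p k * term i m k)

  term-vanish : ∀ {i m k} → k < i → term i m k ≡ 0
  term-vanish {m = m} {k} k<i = trans (cong (w m k *_) (k>n⇒nCk≡0 k<i)) (*-zeroʳ (w m k))

  dSum≡Σ : ∀ {i m} → i ≤ m → dSum i m ≡ Σ< (suc m) (term i m)
  dSum≡Σ {i} {m} i≤m = sumFromTo≡Σ (term i m) i≤m (λ k → term-vanish)

  M-+ : ∀ i m p q → M i m (λ k → p k + q k) ≡ M i m p + M i m q
  M-+ i m p q = trans (Σ-cong (suc m) (λ k _ → *-distribʳ-+ (term i m k) (p k) (q k)))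
                      (Σ-+ (suc m) (λ k → p k * term i m k) (λ k → q k * term i m k))

  M-scale : ∀ i m c p → M i m (λ k → c * p k) ≡ c * M i m p
  M-scale i m c p = trans (Σ-cong (suc m) (λ k _ → *-assoc c (p k) (term i m k)))
                          (Σ-scale (suc m) c (λ k → p k * term i m k))

  M-const : ∀ {i m} c → i ≤ m → M i m (λ _ → c) ≡ c * dSum i m
  M-const {i} {m} c i≤m = trans (Σ-scale (suc m) c (term i m)) (cong (c *_) (sym (dSum≡Σ i≤m)))

  -- the coefficient k - i turns C(k, i) into (i+1) C(k, i+1)
  M-lower : ∀ {i m} → suc i ≤ m → M i m (λ k → k ∸ i) ≡ suc i * dSum (suc i) m
  M-lower {i} {m} i<m = begin
    Σ< (suc m) (λ k → (k ∸ i) * (w m k * (k C i)))     ≡⟨ Σ-cong (suc m) (λ k _ → lower k) ⟩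
    Σ< (suc m) (λ k → suc i * term (suc i) m k)        ≡⟨ Σ-scale (suc m) (suc i) (term (suc i) m) ⟩
    suc i * Σ< (suc m) (term (suc i) m)                ≡⟨ cong (suc i *_) (dSum≡Σ i<m) ⟨
    suc i * dSum (suc i) m                             ∎
    where
    lower : ∀ k → (k ∸ i) * (w m k * (k C i)) ≡ suc i * (w m k * (k C suc i))
    lower k = begin
      (k ∸ i) * (w m k * (k C i))     ≡⟨ x∙yz≈y∙xz (k ∸ i) (w m k) (k C i) ⟩
      w m k * ((k ∸ i) * (k C i))     ≡⟨ cong (w m k *_) (C-lower k i) ⟨
      w m k * (suc i * (k C suc i))   ≡⟨ x∙yz≈y∙xz (w m k) (suc i) (k C suc i) ⟩
      suc i * (w m k * (k C suc i))   ∎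

  M-cong : ∀ {i m} p q → (∀ k → i ≤ k → k ≤ m → p k ≡ q k) → M i m p ≡ M i m q
  M-cong {i} {m} p q eq = Σ-cong (suc m) pointwise
    where
    pointwise : ∀ k → k < suc m → p k * term i m k ≡ q k * term i m k
    pointwise k (s≤s k≤m) with i ≤? k
    ... | yes i≤k = cong (_* term i m k) (eq k i≤k k≤m)
    ... | no  i≰k rewrite term-vanish {i} {m} (≰⇒> i≰k) = trans (*-zeroʳ (p k)) (sym (*-zeroʳ (q k)))

  M-mono : ∀ {i m} p q → (∀ k → i ≤ k → k ≤ m → p k ≤ q k) → M i m p ≤ M i m q
  M-mono {i} {m} p q le = Σ-mono (suc m) pointwise
    where
    pointwise : ∀ k → k < suc m → p k * term i m k ≤ q k * term i m k
    pointwise k (s≤s k≤m) with i ≤? k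
    ... | yes i≤k = *-monoˡ-≤ (term i m k) (le k i≤k k≤m)
    ... | no  i≰k rewrite term-vanish {i} {m} (≰⇒> i≰k) | *-zeroʳ (p k) = z≤n

  M-transfer : ∀ {i m} p q g h → (∀ k → i ≤ k → k ≤ m → p k + g k ≡ q k + h k) →
               M i m g ≡ M i m h → M i m p ≡ M i m q
  M-transfer {i} {m} p q g h eq Mg≡Mh = +-cancelʳ-≡ (M i m g) _ _ (begin
    M i m p + M i m g                 ≡⟨ M-+ i m p g ⟨
    M i m (λ k → p k + g k)           ≡⟨ M-cong _ _ eq ⟩
    M i m (λ k → q k + h k)           ≡⟨ M-+ i m q h ⟩
    M i m q + M i m h                 ≡⟨ cong (M i m q +_) Mg≡Mh ⟨
    M i m q + M i m g                 ∎)

  up-both : ∀ {i m} → i ≤ m →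
            suc i * (suc m * dSum (suc i) (suc m)) ≡ M i m (λ k → 2 * ((m + k + 1) * (m + k + 2)))
  up-both {i} {m} i≤m = begin
    suc i * (suc m * dSum (suc i) (suc m))
      ≡⟨ cong (λ z → suc i * (suc m * z)) (trans (dSum≡Σ (s≤s i≤m)) (Σ-shift (suc m) f)) ⟩
    suc i * (suc m * (f 0 + Σ< (suc m) (λ k → f (suc k))))
      ≡⟨ cong (λ z → suc i * (suc m * (z + Σ< (suc m) (λ k → f (suc k))))) (*-zeroʳ (w (suc m) 0)) ⟩
    suc i * (suc m * Σ< (suc m) (λ k → f (suc k)))
      ≡⟨ cong (suc i *_) (Σ-scale (suc m) (suc m) (λ k → f (suc k))) ⟨
    suc i * Σ< (suc m) (λ k → suc m * f (suc k))
      ≡⟨ Σ-scale (suc m) (suc i) (λ k → suc m * f (suc k)) ⟨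
    Σ< (suc m) (λ k → suc i * (suc m * f (suc k)))
      ≡⟨ Σ-cong (suc m) (λ k k≤m → step k (≤-pred k≤m)) ⟩
    M i m (λ k → 2 * ((m + k + 1) * (m + k + 2))) ∎
    where
    f : ℕ → ℕ
    f = term (suc i) (suc m)
    shuffle : ∀ a b x c → a * (b * (x * c)) ≡ b * x * (a * c)
    shuffle = solve-∀
    unshuffle : ∀ b x k c → b * x * (k * c) ≡ b * (k * x) * c
    unshuffle = solve-∀
    step : ∀ k → k ≤ m → suc i * (suc m * f (suc k)) ≡ 2 * ((m + k + 1) * (m + k + 2)) * term i m k
    step k k≤m = begin
      suc i * (suc m * (w (suc m) (suc k) * (suc k C suc i)))
        ≡⟨ shuffle (suc i) (suc m) (w (suc m) (suc k)) (suc k C suc i) ⟩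
      suc m * w (suc m) (suc k) * (suc i * (suc k C suc i))
        ≡⟨ cong (suc m * w (suc m) (suc k) *_) (C-absorb k i) ⟩
      suc m * w (suc m) (suc k) * (suc k * (k C i))
        ≡⟨ unshuffle (suc m) (w (suc m) (suc k)) (suc k) (k C i) ⟩
      suc m * (suc k * w (suc m) (suc k)) * (k C i)
        ≡⟨ cong (_* (k C i)) (w-step-mk k≤m) ⟩
      2 * ((m + k + 1) * (m + k + 2)) * w m k * (k C i)
        ≡⟨ *-assoc (2 * ((m + k + 1) * (m + k + 2))) (w m k) (k C i) ⟩
      2 * ((m + k + 1) * (m + k + 2)) * term i m k ∎

  -- the contiguity relation in k, summed:  it rebalances the coefficient (k - i)
  balance : ∀ i m → M i m (λ k → (2 * (m ∸ k) + 1) * (k ∸ i)) ≡ M i m (λ k → (m ∸ k) * (m + k + 1))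
  balance i m = begin
    Σ< (suc m) f                         ≡⟨ Σ-shift m f ⟩
    f 0 + Σ< m (λ k → f (suc k))         ≡⟨ cong₂ _+_ f0≡0 (Σ-cong m (λ k k<m → step k k<m)) ⟩
    Σ< m g                               ≡⟨ +-identityʳ (Σ< m g) ⟨
    Σ< m g + 0                           ≡⟨ cong (Σ< m g +_) gm≡0 ⟨
    Σ< m g + g m                         ∎
    where
    f g : ℕ → ℕ
    f k = (2 * (m ∸ k) + 1) * (k ∸ i) * term i m k
    g k = (m ∸ k) * (m + k + 1) * term i m k
    f0≡0 : f 0 ≡ 0
    f0≡0 = trans (cong (λ z → (2 * m + 1) * z * term i m 0) (0∸n≡0 i))
                 (cong (_* term i m 0) (*-zeroʳ (2 * m + 1)))
    gm≡0 : g m ≡ 0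
    gm≡0 = cong (λ z → z * (m + m + 1) * term i m m) (n∸n≡0 m)
    shuffle : ∀ a b x c → a * b * (x * c) ≡ a * x * (b * c)
    shuffle = solve-∀
    unshuffle : ∀ a x s c → a * x * (s * c) ≡ a * (s * x) * c
    unshuffle = solve-∀
    step : ∀ k → k < m → f (suc k) ≡ g k
    step k k<m = begin
      (2 * (m ∸ suc k) + 1) * (suc k ∸ i) * (w m (suc k) * (suc k C i))
        ≡⟨ shuffle (2 * (m ∸ suc k) + 1) (suc k ∸ i) (w m (suc k)) (suc k C i) ⟩
      (2 * (m ∸ suc k) + 1) * w m (suc k) * ((suc k ∸ i) * (suc k C i))
        ≡⟨ cong ((2 * (m ∸ suc k) + 1) * w m (suc k) *_) (C-shift k i) ⟩
      (2 * (m ∸ suc k) + 1) * w m (suc k) * (suc k * (k C i))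
        ≡⟨ unshuffle (2 * (m ∸ suc k) + 1) (w m (suc k)) (suc k) (k C i) ⟩
      (2 * (m ∸ suc k) + 1) * (suc k * w m (suc k)) * (k C i)
        ≡⟨ cong (_* (k C i)) (w-step-k k<m) ⟩
      (m ∸ k) * (m + k + 1) * w m k * (k C i)
        ≡⟨ *-assoc ((m ∸ k) * (m + k + 1)) (w m k) (k C i) ⟩
      g k ∎

  up-m : ∀ {i m} → i ≤ m →
         (suc m ∸ i) * (suc m * dSum i (suc m))
           ≡ M i m (λ k → 2 * ((2 * (m ∸ k) + 1) * (suc m + k))) + M i m (λ k → 2 * ((m + k + 1) * (m + k + 2)))
  up-m {i} {m} i≤m = begin
    (suc m ∸ i) * (suc m * dSum i (suc m))
      ≡⟨ *-assoc (suc m ∸ i) (suc m) (dSum i (suc m)) ⟨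
    (suc m ∸ i) * suc m * dSum i (suc m)
      ≡⟨ M-const ((suc m ∸ i) * suc m) (m≤n⇒m≤1+n i≤m) ⟨
    M i (suc m) (λ _ → (suc m ∸ i) * suc m)
      ≡⟨ M-cong _ _ split ⟩
    M i (suc m) (λ k → (suc m ∸ k) * suc m + suc m * (k ∸ i))
      ≡⟨ M-+ i (suc m) (λ k → (suc m ∸ k) * suc m) (λ k → suc m * (k ∸ i)) ⟩
    M i (suc m) (λ k → (suc m ∸ k) * suc m) + M i (suc m) (λ k → suc m * (k ∸ i))
      ≡⟨ cong₂ _+_ lower-m (trans (M-scale i (suc m) (suc m) (λ k → k ∸ i)) lower-i) ⟩
    M i m (λ k → 2 * ((2 * (m ∸ k) + 1) * (suc m + k))) + M i m (λ k → 2 * ((m + k + 1) * (m + k + 2))) ∎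
    where
    split : ∀ k → i ≤ k → k ≤ suc m → (suc m ∸ i) * suc m ≡ (suc m ∸ k) * suc m + suc m * (k ∸ i)
    split k i≤k k≤m+1 = begin
      (suc m ∸ i) * suc m                     ≡⟨ cong (λ z → (z ∸ i) * suc m) (m∸n+n≡m k≤m+1) ⟨
      ((suc m ∸ k) + k ∸ i) * suc m           ≡⟨ cong (_* suc m) (+-∸-assoc (suc m ∸ k) i≤k) ⟩
      ((suc m ∸ k) + (k ∸ i)) * suc m         ≡⟨ *-distribʳ-+ (suc m) (suc m ∸ k) (k ∸ i) ⟩
      (suc m ∸ k) * suc m + (k ∸ i) * suc m   ≡⟨ cong ((suc m ∸ k) * suc m +_) (*-comm (k ∸ i) (suc m)) ⟩
      (suc m ∸ k) * suc m + suc m * (k ∸ i)   ∎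
    lower-i : suc m * M i (suc m) (λ k → k ∸ i) ≡ M i m (λ k → 2 * ((m + k + 1) * (m + k + 2)))
    lower-i = begin
      suc m * M i (suc m) (λ k → k ∸ i)         ≡⟨ cong (suc m *_) (M-lower (s≤s i≤m)) ⟩
      suc m * (suc i * dSum (suc i) (suc m))    ≡⟨ x∙yz≈y∙xz (suc m) (suc i) _ ⟩
      suc i * (suc m * dSum (suc i) (suc m))    ≡⟨ up-both i≤m ⟩
      M i m (λ k → 2 * ((m + k + 1) * (m + k + 2))) ∎
    h : ℕ → ℕ
    h k = (suc m ∸ k) * suc m * term i (suc m) k
    regroup : ∀ d s x c → d * s * (x * c) ≡ d * (s * x) * c
    regroup = solve-∀
    step : ∀ k → k < suc m → h k ≡ 2 * ((2 * (m ∸ k) + 1) * (suc m + k)) * term i m k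
    step k (s≤s k≤m) = begin
      (suc m ∸ k) * suc m * (w (suc m) k * (k C i))   ≡⟨ regroup (suc m ∸ k) (suc m) (w (suc m) k) (k C i) ⟩
      (suc m ∸ k) * (suc m * w (suc m) k) * (k C i)   ≡⟨ cong (_* (k C i)) (w-step-m k≤m) ⟩
      2 * ((2 * (m ∸ k) + 1) * (suc m + k)) * w m k * (k C i)
        ≡⟨ *-assoc (2 * ((2 * (m ∸ k) + 1) * (suc m + k))) (w m k) (k C i) ⟩
      2 * ((2 * (m ∸ k) + 1) * (suc m + k)) * term i m k ∎
    lower-m : M i (suc m) (λ k → (suc m ∸ k) * suc m) ≡ M i m (λ k → 2 * ((2 * (m ∸ k) + 1) * (suc m + k)))
    lower-m = begin
      Σ< (suc m) h + h (suc m)    ≡⟨ cong (Σ< (suc m) h +_) (cong (λ z → z * suc m * term i (suc m) (suc m)) (n∸n≡0 m)) ⟩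
      Σ< (suc m) h + 0            ≡⟨ +-identityʳ _ ⟩
      Σ< (suc m) h                ≡⟨ Σ-cong (suc m) step ⟩
      M i m (λ k → 2 * ((2 * (m ∸ k) + 1) * (suc m + k))) ∎

module Recurrences where
  open import Data.Nat
  open import Data.Nat.Properties
  open import Data.Nat.Combinatorics using (_C_)
  open import Data.Nat.Tactic.RingSolver using (solve-∀; solve)
  open import Data.List using (_∷_; [])
  open import Relation.Binary.PropositionalEquality
  open Sums
  open Elementary
  open Binomial
  open Weights
  open Moments

  balance₂ : ∀ i m → M i m (λ k → 2 * ((2 * (m ∸ k) + 1) * (k ∸ i))) ≡ M i m (λ k → 2 * ((m ∸ k) * (m + k + 1)))
  balance₂ i m = begin
    M i m (λ k → 2 * ((2 * (m ∸ k) + 1) * (k ∸ i)))  ≡⟨ M-scale i m 2 (λ k → (2 * (m ∸ k) + 1) * (k ∸ i)) ⟩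
    2 * M i m (λ k → (2 * (m ∸ k) + 1) * (k ∸ i))    ≡⟨ cong (2 *_) (balance i m) ⟩
    2 * M i m (λ k → (m ∸ k) * (m + k + 1))          ≡⟨ M-scale i m 2 (λ k → (m ∸ k) * (m + k + 1)) ⟨
    M i m (λ k → 2 * ((m ∸ k) * (m + k + 1)))        ∎
    where open ≡-Reasoning

  -- the two polynomial identities behind the recurrences, for i ≤ k ≤ m
  Identity₁ Identity₂ : ℕ → ℕ → ℕ → Set
  Identity₁ i k m = 2 * ((m + k + 1) * (m + k + 2)) + 2 * ((2 * (m ∸ k) + 1) * (k ∸ i))
                      ≡ (4 * (m + i + 1) * suc i + 2 * (4 * m + 2 * i + 5) * (k ∸ i)) + 2 * ((m ∸ k) * (m + k + 1))
  Identity₂ i k m = 2 * ((2 * (m ∸ k) + 1) * (suc m + k)) + 2 * ((m + k + 1) * (m + k + 2)) + 4 * i * (k ∸ i)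
                      + 2 * ((m ∸ k) * (m + k + 1))
                      ≡ 2 * ((2 * i + 4 * (m ∸ i) + 3) * (m + i + 1)) + 2 * ((2 * (m ∸ k) + 1) * (k ∸ i))

  identity₁ : ∀ {i k m} → i ≤ k → k ≤ m → Identity₁ i k m
  identity₁ {i} i≤k k≤m = by-offsets (Identity₁ i) i≤k k≤m polynomial
    where
    polynomial : ∀ t r → Identity₁ i (i + t) (i + t + r)
    polynomial t r rewrite m+n∸m≡n (i + t) r | m+n∸m≡n i t = solve (i ∷ t ∷ r ∷ [])

  identity₂ : ∀ {i k m} → i ≤ k → k ≤ m → Identity₂ i k m
  identity₂ {i} i≤k k≤m = by-offsets (Identity₂ i) i≤k k≤m polynomial
    where
    polynomial : ∀ t r → Identity₂ i (i + t) (i + t + r)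
    polynomial t r rewrite m+n∸m≡n (i + t) r | m+n∸m≡n i t
                         | trans (cong (_∸ i) (+-assoc i t r)) (m+n∸m≡n i (t + r)) = solve (i ∷ t ∷ r ∷ [])

  recurrence-i+1 : ∀ {i m} → suc i ≤ m →
    suc m * dSum (suc i) (suc m) ≡ 4 * (m + i + 1) * dSum i m + 2 * (4 * m + 2 * i + 5) * dSum (suc i) m
  recurrence-i+1 {i} {m} i<m = *-cancelˡ-≡ _ _ (suc i) (begin
    suc i * (suc m * dSum (suc i) (suc m))    ≡⟨ up-both i≤m ⟩
    M i m b                                   ≡⟨ M-transfer b r₁ (λ k → 2 * g₁ k) (λ k → 2 * g₂ k) (λ _ → identity₁ {i}) (balance₂ i m) ⟩
    M i m r₁                                  ≡⟨ M-+ i m (λ _ → c₀) (λ k → c₁ * (k ∸ i)) ⟩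
    M i m (λ _ → c₀) + M i m (λ k → c₁ * (k ∸ i))
      ≡⟨ cong₂ _+_ (M-const c₀ i≤m) (trans (M-scale i m c₁ (λ k → k ∸ i)) (cong (c₁ *_) (M-lower i<m))) ⟩
    c₀ * dSum i m + c₁ * (suc i * dSum (suc i) m) ≡⟨ factor (4 * (m + i + 1)) i c₁ (dSum i m) (dSum (suc i) m) ⟩
    suc i * (4 * (m + i + 1) * dSum i m + c₁ * dSum (suc i) m) ∎)
    where
    open ≡-Reasoning
    i≤m : i ≤ m
    i≤m = <⇒≤ i<m
    c₀ c₁ : ℕ
    c₀ = 4 * (m + i + 1) * suc i
    c₁ = 2 * (4 * m + 2 * i + 5)
    b g₁ g₂ r₁ : ℕ → ℕ
    b k = 2 * ((m + k + 1) * (m + k + 2))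
    g₁ k = (2 * (m ∸ k) + 1) * (k ∸ i)
    g₂ k = (m ∸ k) * (m + k + 1)
    r₁ k = c₀ + c₁ * (k ∸ i)
    factor : ∀ a i c s₀ s₁ → a * suc i * s₀ + c * (suc i * s₁) ≡ suc i * (a * s₀ + c * s₁)
    factor = solve-∀

  recurrence-m+1 : ∀ {i m} → suc i ≤ m →
    suc (m ∸ i) * (suc m * dSum i (suc m)) + 4 * i * (suc i * dSum (suc i) m)
      ≡ 2 * ((2 * i + 4 * (m ∸ i) + 3) * (m + i + 1)) * dSum i m
  recurrence-m+1 {i} {m} i<m = begin
    suc (m ∸ i) * (suc m * dSum i (suc m)) + 4 * i * (suc i * dSum (suc i) m)
      ≡⟨ cong (λ z → z * (suc m * dSum i (suc m)) + 4 * i * (suc i * dSum (suc i) m)) (+-∸-assoc 1 i≤m) ⟨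
    (suc m ∸ i) * (suc m * dSum i (suc m)) + 4 * i * (suc i * dSum (suc i) m)
      ≡⟨ cong₂ _+_ (up-m i≤m) (trans (cong (4 * i *_) (sym (M-lower i<m))) (sym (M-scale i m (4 * i) (λ k → k ∸ i)))) ⟩
    M i m c + M i m b + M i m e          ≡⟨ cong (_+ M i m e) (M-+ i m c b) ⟨
    M i m (λ k → c k + b k) + M i m e    ≡⟨ M-+ i m (λ k → c k + b k) e ⟨
    M i m (λ k → c k + b k + e k)        ≡⟨ M-transfer (λ k → c k + b k + e k) (λ _ → r₂) (λ k → 2 * g₂ k) (λ k → 2 * g₁ k) (λ _ → identity₂ {i}) (sym (balance₂ i m)) ⟩
    M i m (λ _ → r₂)                     ≡⟨ M-const r₂ i≤m ⟩
    r₂ * dSum i m                        ∎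
    where
    open ≡-Reasoning
    i≤m : i ≤ m
    i≤m = <⇒≤ i<m
    r₂ : ℕ
    r₂ = 2 * ((2 * i + 4 * (m ∸ i) + 3) * (m + i + 1))
    b c e g₁ g₂ : ℕ → ℕ
    b k = 2 * ((m + k + 1) * (m + k + 2))
    c k = 2 * ((2 * (m ∸ k) + 1) * (suc m + k))
    e k = 4 * i * (k ∸ i)
    g₁ k = (2 * (m ∸ k) + 1) * (k ∸ i)
    g₂ k = (m ∸ k) * (m + k + 1)

  -- (i+1) d_{i+1}(m) ≤ (m-i) d_i(m), since k - i ≤ m - i on the support
  lower-bound : ∀ {i m} → suc i ≤ m → suc i * dSum (suc i) m ≤ (m ∸ i) * dSum i m
  lower-bound {i} {m} i<m = begin
    suc i * dSum (suc i) m      ≡⟨ M-lower i<m ⟨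
    M i m (λ k → k ∸ i)         ≤⟨ M-mono {i} {m} (λ k → k ∸ i) (λ _ → m ∸ i) (λ k _ k≤m → ∸-monoˡ-≤ i k≤m) ⟩
    M i m (λ _ → m ∸ i)         ≡⟨ M-const (m ∸ i) (<⇒≤ i<m) ⟩
    (m ∸ i) * dSum i m          ∎
    where open ≤-Reasoning

  -- the coefficients are positive: the summand k = m is
  dSum-pos : ∀ {j m} → j ≤ m → 0 < dSum j m
  dSum-pos {j} {m} j≤m = begin-strict
    0                           <⟨ *-pos (*-pos (*-pos (m^n>0 2 m) central-pos) (C-pos (m≤n+m m m))) (C-pos j≤m) ⟩
    term j m m                  ≤⟨ m≤n+m (term j m m) _ ⟩
    Σ< (suc m) (term j m)       ≡⟨ dSum≡Σ j≤m ⟨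
    dSum j m                    ∎
    where
    open ≤-Reasoning
    central-pos : 0 < (2 * m ∸ 2 * m) C (m ∸ m)
    central-pos = subst₂ (λ a b → 0 < a C b) (sym (n∸n≡0 (2 * m))) (sym (n∸n≡0 m)) (s≤s z≤n)

module Inequality where
  open import Data.Nat
  open import Data.Nat.Properties
  open import Data.Nat.Tactic.RingSolver using (solve-∀; solve)
  open import Data.List using (_∷_; [])
  open import Relation.Binary.PropositionalEquality
  open ≤-Reasoning
  open Elementary

  -- for x ≤ y ≤ z:  x (y + z) ≤ x² + y z,  as (y - x)(z - x) ≥ 0
  quadratic : ∀ {x y z} → x ≤ y → y ≤ z → x * (y + z) ≤ x * x + y * z
  quadratic {x} x≤y y≤z = by-offsets (λ y z → x * (y + z) ≤ x * x + y * z) x≤y y≤z λ e f →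
    subst (x * (x + e + (x + e + f)) ≤_) (expand x e f) (m≤m+n _ (e * (e + f)))
    where
    expand : ∀ x e f → x * (x + e + (x + e + f)) + e * (e + f) ≡ x * x + (x + e) * (x + e + f)
    expand = solve-∀

  -- the quadratic inequality behind the theorem: with x = (i+1) s₁ ≤ y = q s₀ ≤ z = p s₀,
  -- (i+1) α (q+p) s₀ s₁ = α x (y + z) ≤ α (x² + y z), and α q < (i+1) β makes it strict
  key : ∀ {α β i q p s₀ s₁} → suc i * s₁ ≤ q * s₀ → q ≤ p → α * q < suc i * β → 0 < p * (s₀ * s₀) →
        α * (q + p) * (s₀ * s₁) < β * p * (s₀ * s₀) + α * suc i * (s₁ * s₁)
  key {α} {β} {i} {q} {p} {s₀} {s₁} x≤y q≤p αq<[i+1]β ps₀²>0 = *-cancelˡ-< (suc i) _ _ (begin-strict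
    suc i * (α * (q + p) * (s₀ * s₁))                   ≡⟨ solve (α ∷ i ∷ q ∷ p ∷ s₀ ∷ s₁ ∷ []) ⟩
    α * (suc i * s₁ * (q * s₀ + p * s₀))                ≤⟨ *-monoʳ-≤ α (quadratic x≤y (*-monoˡ-≤ s₀ q≤p)) ⟩
    α * (suc i * s₁ * (suc i * s₁) + q * s₀ * (p * s₀)) ≡⟨ solve (α ∷ i ∷ q ∷ p ∷ s₀ ∷ s₁ ∷ []) ⟩
    α * (suc i * s₁ * (suc i * s₁)) + α * q * (p * (s₀ * s₀))
      <⟨ +-monoʳ-< (α * (suc i * s₁ * (suc i * s₁))) (*-monoˡ-< (p * (s₀ * s₀)) {{>-nonZero ps₀²>0}} αq<[i+1]β) ⟩
    α * (suc i * s₁ * (suc i * s₁)) + suc i * β * (p * (s₀ * s₀)) ≡⟨ solve (α ∷ β ∷ i ∷ p ∷ s₀ ∷ s₁ ∷ []) ⟩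
    suc i * (β * p * (s₀ * s₀) + α * suc i * (s₁ * s₁)) ∎)

  ratio-inequality : ∀ {i q m s₀ s₁ u₀ u₁} → i + q ≡ m → 0 < s₀ →
    suc m * u₁ ≡ 4 * (m + i + 1) * s₀ + 2 * (4 * m + 2 * i + 5) * s₁ →
    suc q * (suc m * u₀) + 4 * i * (suc i * s₁) ≡ 2 * ((2 * i + 4 * q + 3) * (m + i + 1)) * s₀ →
    suc i * s₁ ≤ q * s₀ →
    (5 + 2 * i + 4 * m) * u₀ * s₁ < (3 + 2 * i + 4 * m) * s₀ * u₁
  ratio-inequality {i} {q} {_} {s₀} {s₁} {u₀} {u₁} refl s₀>0 rec₁ rec₂ bound =
    let m : ℕ
        m = i + q
        A : ℕ
        A = 5 + 2 * i + 4 * (i + q)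
        B : ℕ
        B = 3 + 2 * i + 4 * (i + q)
        P : ℕ
        P = i + q + i + 1
        E : ℕ
        E = A * s₁ * (4 * i * (suc i * s₁))
    in *-cancelˡ-< (suc q * suc m) _ _ (+-cancelʳ-< E _ _ (begin-strict
    suc q * suc m * (A * u₀ * s₁) + E              ≡⟨ solve (i ∷ q ∷ s₀ ∷ s₁ ∷ u₀ ∷ []) ⟩
    A * s₁ * (suc q * (suc m * u₀) + 4 * i * (suc i * s₁)) ≡⟨ cong (A * s₁ *_) rec₂ ⟩
    A * s₁ * (2 * ((2 * i + 4 * q + 3) * P) * s₀)  ≡⟨ solve (i ∷ q ∷ s₀ ∷ s₁ ∷ []) ⟩
    2 * A * (B * suc q) * (s₀ * s₁) + 4 * (A * i * (q + P) * (s₀ * s₁))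
      <⟨ +-monoʳ-< (2 * A * (B * suc q) * (s₀ * s₁)) (*-monoʳ-< 4 (key {A * i} {B * suc q} {i} {q} {P} {s₀} {s₁} bound q≤P coefficient Ps₀²>0)) ⟩
    2 * A * (B * suc q) * (s₀ * s₁) + 4 * (B * suc q * P * (s₀ * s₀) + A * i * suc i * (s₁ * s₁))
                                                   ≡⟨ solve (i ∷ q ∷ s₀ ∷ s₁ ∷ []) ⟩
    B * s₀ * suc q * (4 * P * s₀ + 2 * (4 * m + 2 * i + 5) * s₁) + E ≡⟨ cong (λ z → B * s₀ * suc q * z + E) rec₁ ⟨
    B * s₀ * suc q * (suc m * u₁) + E               ≡⟨ solve (i ∷ q ∷ s₀ ∷ s₁ ∷ u₁ ∷ []) ⟩
    suc q * suc m * (B * s₀ * u₁) + E              ∎))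
    where
    q≤P : q ≤ i + q + i + 1
    q≤P = ≤-trans (m≤n+m q i) (≤-trans (m≤m+n (i + q) i) (m≤m+n (i + q + i) 1))
    Ps₀²>0 : 0 < (i + q + i + 1) * (s₀ * s₀)
    Ps₀²>0 = *-pos (≤-<-trans z≤n (m<m+n (i + q + i) (s≤s z≤n))) (*-pos s₀>0 s₀>0)
    excess : ∀ i q → suc i * ((3 + 2 * i + 4 * (i + q)) * suc q)
                     ≡ (5 + 2 * i + 4 * (i + q)) * i * q + suc (2 + 7 * q + 4 * (q * q) + 9 * i + 6 * (i * i) + 8 * (i * q))
    excess = solve-∀
    coefficient : (5 + 2 * i + 4 * (i + q)) * i * q < suc i * ((3 + 2 * i + 4 * (i + q)) * suc q)
    coefficient = subst ((5 + 2 * i + 4 * (i + q)) * i * q <_) (sym (excess i q)) (m<m+n _ (s≤s z≤n))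

module Fractions where
  open import Data.Nat as ℕ using (ℕ; suc)
  open import Data.Nat.Properties using (m*n≢0)
  import Data.Nat.Properties as ℕₚ
  open import Data.Integer using (+_)
  import Data.Integer as ℤ
  open import Data.Integer.Properties using (pos-*)
  open import Data.Rational using (_/_; _*_; _÷_; _<_; 1/_; 1ℚ; NonZero; toℚᵘ)
  open import Data.Rational.Properties using (toℚᵘ-fromℚᵘ; toℚᵘ-injective; toℚᵘ-homo-*; toℚᵘ-cancel-<;
    *-assoc; *-inverseʳ; *-identityʳ)
  import Data.Rational.Unnormalised as ℚᵘ
  open import Data.Rational.Unnormalised using (*≡*; *<*) renaming (_≃_ to _≃ᵘ_)
  import Data.Rational.Unnormalised.Properties as ℚᵘ
  open import Relation.Binary.PropositionalEquality

  toℚᵘ-/ : ∀ a b .{{_ : ℕ.NonZero b}} → toℚᵘ (+ a / b) ≃ᵘ (+ a) ℚᵘ./ b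
  toℚᵘ-/ a (suc b) = toℚᵘ-fromℚᵘ (ℚᵘ.mkℚᵘ (+ a) b)

  frac-* : ∀ a b c e .{{_ : ℕ.NonZero b}} .{{_ : ℕ.NonZero e}} →
           (+ a / b) * (+ c / e) ≡ (+ (a ℕ.* c) / (b ℕ.* e)) {{m*n≢0 b e}}
  frac-* a b@(suc _) c e@(suc _) = toℚᵘ-injective (ℚᵘ.≃-trans (toℚᵘ-homo-* (+ a / b) (+ c / e))
    (ℚᵘ.≃-trans (ℚᵘ.*-cong (toℚᵘ-/ a b) (toℚᵘ-/ c e))
      (ℚᵘ.≃-trans (ℚᵘ.≃-reflexive (cong (λ z → (z ℚᵘ./ (b ℕ.* e)) {{m*n≢0 b e}}) (sym (pos-* a c))))
        (ℚᵘ.≃-sym (toℚᵘ-/ (a ℕ.* c) (b ℕ.* e) {{m*n≢0 b e}})))))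

  frac-cancel : ∀ a b n .{{_ : ℕ.NonZero b}} .{{_ : ℕ.NonZero n}} →
                (+ (a ℕ.* b) / (b ℕ.* n)) {{m*n≢0 b n}} ≡ + a / n
  frac-cancel a b@(suc _) n@(suc _) = toℚᵘ-injective (ℚᵘ.≃-trans (toℚᵘ-/ (a ℕ.* b) (b ℕ.* n) {{m*n≢0 b n}})
    (ℚᵘ.≃-trans (*≡* cross) (ℚᵘ.≃-sym (toℚᵘ-/ a n))))
    where
    cross : + (a ℕ.* b) ℤ.* + n ≡ + a ℤ.* + (b ℕ.* n)
    cross = trans (sym (pos-* (a ℕ.* b) n)) (trans (cong +_ (ℕₚ.*-assoc a b n)) (pos-* a (b ℕ.* n)))

  frac-÷ : ∀ a b n .{{_ : ℕ.NonZero b}} .{{_ : ℕ.NonZero n}} .{{_ : NonZero (+ b / n)}} →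
           (+ a / n) ÷ (+ b / n) ≡ + a / b
  frac-÷ a b n = begin
    (+ a / n) * 1/ (+ b / n)                       ≡⟨ cong (_* 1/ (+ b / n)) a/n≡a/b*b/n ⟩
    ((+ a / b) * (+ b / n)) * 1/ (+ b / n)         ≡⟨ *-assoc (+ a / b) (+ b / n) (1/ (+ b / n)) ⟩
    (+ a / b) * ((+ b / n) * 1/ (+ b / n))         ≡⟨ cong ((+ a / b) *_) (*-inverseʳ (+ b / n)) ⟩
    (+ a / b) * 1ℚ                                  ≡⟨ *-identityʳ (+ a / b) ⟩
    + a / b                                        ∎
    where
    open ≡-Reasoning
    a/n≡a/b*b/n : + a / n ≡ (+ a / b) * (+ b / n)
    a/n≡a/b*b/n = sym (trans (frac-* a b b n) (frac-cancel a b n))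

  frac-< : ∀ a b c e .{{_ : ℕ.NonZero b}} .{{_ : ℕ.NonZero e}} → a ℕ.* e ℕ.< c ℕ.* b → + a / b < + c / e
  frac-< a b@(suc _) c e@(suc _) ae<cb = toℚᵘ-cancel-<
    (ℚᵘ.<-respˡ-≃ (ℚᵘ.≃-sym (toℚᵘ-/ a b)) (ℚᵘ.<-respʳ-≃ (ℚᵘ.≃-sym (toℚᵘ-/ c e))
      (*<* (subst₂ ℤ._<_ (pos-* a e) (pos-* c b) (ℤ.+<+ ae<cb)))))

open import Data.Nat using (ℕ; suc; _≤_; _∸_)
open import Data.Integer using (+_)
open import Data.Rational using (ℚ; _<_; _*_; _÷_; _/_; NonZero)
import Data.Nat as ℕ
import Data.Nat.Properties as ℕₚ
open import Data.Nat.Tactic.RingSolver using (solve-∀)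
open import Relation.Binary.PropositionalEquality using (_≡_; cong; subst; subst₂; sym; trans)
open Recurrences using (recurrence-i+1; recurrence-m+1; lower-bound; dSum-pos)
open Inequality using (ratio-inequality)
open Fractions using (frac-*; frac-÷; frac-<)
open Elementary using (<-from-pred)

integer-form : ∀ {m i} → suc i ≤ m →
  (5 ℕ.+ 2 ℕ.* i ℕ.+ 4 ℕ.* m) ℕ.* dSum i (suc m) ℕ.* dSum (suc i) m
    ℕ.< (3 ℕ.+ 2 ℕ.* i ℕ.+ 4 ℕ.* m) ℕ.* dSum i m ℕ.* dSum (suc i) (suc m)
integer-form i<m = ratio-inequality (ℕₚ.m+[n∸m]≡n (ℕₚ.<⇒≤ i<m)) (dSum-pos (ℕₚ.<⇒≤ i<m))
  (recurrence-i+1 i<m) (recurrence-m+1 i<m) (lower-bound i<m)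

lemma2p3 : ∀ (m i : ℕ) → 2 ≤ m → i ≤ m ∸ 1 →
    .{{_ : NonZero (d (suc i) m)}} → .{{_ : NonZero (d (suc i) (suc m))}} →
    (+ (5 Data.Nat.+ 2 Data.Nat.* i Data.Nat.+ 4 Data.Nat.* m) / (3 Data.Nat.+ 2 Data.Nat.* i Data.Nat.+ 4 Data.Nat.* m))
      * (d i (suc m) ÷ d (suc i) (suc m))
      < d i m ÷ d (suc i) m
lemma2p3 m i 2≤m i≤m-1 = subst₂ _<_ (sym lhs) (sym rhs) (frac-< (A ℕ.* u₀) (B ℕ.* u₁) s₀ s₁ cross)
  where
  i<m : suc i ≤ m
  i<m = <-from-pred (ℕₚ.<⇒≤ 2≤m) i≤m-1
  A B s₀ s₁ u₀ u₁ : ℕ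
  A = 5 ℕ.+ 2 ℕ.* i ℕ.+ 4 ℕ.* m
  B = 3 ℕ.+ 2 ℕ.* i ℕ.+ 4 ℕ.* m
  s₀ = dSum i m
  s₁ = dSum (suc i) m
  u₀ = dSum i (suc m)
  u₁ = dSum (suc i) (suc m)
  instance
    2^2m≢0 : ℕ.NonZero (2 ℕ.^ (2 ℕ.* m))
    2^2m≢0 = ℕₚ.m^n≢0 2 (2 ℕ.* m)
    2^2m+2≢0 : ℕ.NonZero (2 ℕ.^ (2 ℕ.* suc m))
    2^2m+2≢0 = ℕₚ.m^n≢0 2 (2 ℕ.* suc m)
    s₁≢0 : ℕ.NonZero s₁
    s₁≢0 = ℕ.>-nonZero (dSum-pos i<m)
    u₁≢0 : ℕ.NonZero u₁
    u₁≢0 = ℕ.>-nonZero (dSum-pos (ℕₚ.m≤n⇒m≤1+n i<m))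
    Bu₁≢0 : ℕ.NonZero (B ℕ.* u₁)
    Bu₁≢0 = ℕₚ.m*n≢0 B u₁
  lhs : (+ A / B) * (d i (suc m) ÷ d (suc i) (suc m)) ≡ + (A ℕ.* u₀) / (B ℕ.* u₁)
  lhs = trans (cong ((+ A / B) *_) (frac-÷ u₀ u₁ (2 ℕ.^ (2 ℕ.* suc m)))) (frac-* A B u₀ u₁)
  rhs : d i m ÷ d (suc i) m ≡ + s₀ / s₁
  rhs = frac-÷ s₀ s₁ (2 ℕ.^ (2 ℕ.* m))
  cross : A ℕ.* u₀ ℕ.* s₁ ℕ.< s₀ ℕ.* (B ℕ.* u₁)
  cross = subst (A ℕ.* u₀ ℕ.* s₁ ℕ.<_) (rearrange B s₀ u₁) (integer-form i<m)
    where
    rearrange : ∀ b s u → b ℕ.* s ℕ.* u ≡ s ℕ.* (b ℕ.* u)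
    rearrange = solve-∀
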